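{- Let $T$ be an $\ell$-complete tree decomposition of a graph $G=(V,E)$, rooted at a node $u$, and let $v\neq u$ be a node of $T$. Let $\alpha$ be a $(V\setminus B_u)$-coherent coloring of $G$ such that some color $a$ does not appear on $B_u$. If some vertex of $B_v$ is colored $a$ by $\alpha$, then every bag of a node of $T_v$ contains a vertex colored $a$.
   Context: A tree decomposition of $G$ is a tree $T$ with bags $B_w\subseteq V$ such that every edge lies in some bag and for every vertex the nodes whose bags contain it form a non-empty subtree. It is $\ell$-complete if every bag has exactly $\ell+1$ vertices and adjacent nodes $w,w'$ satisfy $|B_w\cap B_{w'}|=\ell$. Two vertices $x,y$ are parents if there is an edge $ww'$ of $T$ with $B_w\setminus B_{w'}=\{x\}$ and $B_{w'}\setminus B_w=\{y\}$. For $X\subseteq V$, a coloring $\alpha$ is $X$-coherent if $\alpha(x)=\alpha(y)$ for all parents $x,y\in X$, and for every bag $B$ and every $x\in X\cap B$, $x$ is the only vertex of $B$ colored $\alpha(x)$. With $T$ rooted at $u$, $T_v$ denotes the subtree consisting of $v$ and all its descendants. -}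

module Defs where

open import Data.Nat using (ℕ; suc)
open import Data.Fin using (Fin)
open import Data.Fin.Subset using (Subset; _∈_; _∉_; _∩_; _─_; ⁅_⁆; ∁; ∣_∣)
open import Data.Product using (Σ; ∃; ∃₂; _×_)
open import Data.Sum using (_⊎_)
import Data.Empty
open import Function using (_∘_; id)
open import Relation.Binary.PropositionalEquality using (_≡_; _≢_)

iter : {A : Set} → (A → A) → ℕ → A → A
iter f ℕ.zero    = id
iter f (ℕ.suc k) = f ∘ iter f k

record Graph (n : ℕ) : Set₁ where
  field
    E     : Fin n → Fin n → Set
    sym   : ∀ {x y} → E x y → E y x
    irrefl : ∀ {x} → E x x → Data.Empty.⊥
open Graph public

record RootedTree (m : ℕ) : Set where
  field
    root       : Fin m
    par        : Fin m → Fin m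
    par-root   : par root ≡ root
    reachRoot  : ∀ w → ∃ λ k → iter par k w ≡ root
open RootedTree public

module _ {m : ℕ} (T : RootedTree m) where
  TEdge : Fin m → Fin m → Set
  TEdge w w' = (w ≢ root T × par T w ≡ w') ⊎ (w' ≢ root T × par T w' ≡ w)

  -- w is a descendant of v (including v itself), i.e. w is a node of T_v
  InSubtree : Fin m → Fin m → Set
  InSubtree v w = ∃ λ k → iter (par T) k w ≡ v

  data WalkIn (S : Fin m → Set) : Fin m → Fin m → Set where
    here : ∀ {a} → S a → WalkIn S a a
    step : ∀ {a b c} → S a → TEdge a b → WalkIn S b c → WalkIn S a c

  ConnectedSubtree : (Fin m → Set) → Set
  ConnectedSubtree S = (∃ λ w → S w) × (∀ a b → S a → S b → WalkIn S a b)

record TreeDecomposition {n : ℕ} (G : Graph n) (m : ℕ) : Set₁ where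
  field
    T        : RootedTree m
    B        : Fin m → Subset n
    edgeCov  : ∀ x y → E G x y → ∃ λ w → x ∈ B w × y ∈ B w
    vtxConn  : ∀ x → ConnectedSubtree T (λ w → x ∈ B w)
open TreeDecomposition public

Complete : ∀ {n m} {G : Graph n} → ℕ → TreeDecomposition G m → Set
Complete ℓ D =
  (∀ w → ∣ B D w ∣ ≡ suc ℓ) ×
  (∀ w w' → TEdge (T D) w w' → ∣ B D w ∩ B D w' ∣ ≡ ℓ)

Parents : ∀ {n m} {G : Graph n} → TreeDecomposition G m → Fin n → Fin n → Set
Parents D x y = ∃₂ λ w w' → TEdge (T D) w w'
  × (B D w ─ B D w' ≡ ⁅ x ⁆) × (B D w' ─ B D w ≡ ⁅ y ⁆)

ProperColoring : ∀ {n} {C : Set} → Graph n → (Fin n → C) → Set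
ProperColoring G α = ∀ x y → E G x y → α x ≢ α y

Coherent : ∀ {n m} {G : Graph n} {C : Set} → TreeDecomposition G m →
           Subset n → (Fin n → C) → Set
Coherent D X α =
  (∀ x y → x ∈ X → y ∈ X → Parents D x y → α x ≡ α y) ×
  (∀ w x → x ∈ X → x ∈ B D w → ∀ z → z ∈ B D w → α z ≡ α x → z ≡ x)

module Submission where

-- Let w be a non-root node with parent p = par w.  Because the
-- decomposition is ℓ-complete, exactly one vertex z leaves (B p ─ B w = ⁅ z ⁆)
-- and exactly one vertex y enters (B w ─ B p = ⁅ y ⁆) along the edge p w, so
-- z and y are parents.  The entering vertex y never lies in the root bag:
-- otherwise the subtree of bags containing y would join w to the root, and
-- any walk leaving T_w passes through p, forcing y ∈ B p.  Hence if B p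
-- contains a vertex z coloured a (so z ∉ B root, as a is missing there),
-- then either z ∈ B w, or z is the leaving vertex and coherence on
-- V ∖ B root gives α y = α z = a.  So "some vertex of the bag is coloured a"
-- passes from a node to each of its children, and induction down T_v from v
-- proves the theorem.

open import Defs hiding (sym)
open import Data.Nat using (ℕ; zero; suc; _+_; pred)
open import Data.Nat.Properties using (+-suc; +-cancelˡ-≡; +-comm)
open import Data.Bool using (true; false)
open import Data.Vec using ([]; _∷_; here; there)
open import Data.Fin using (Fin) renaming (zero to fzero; suc to fsuc)
open import Data.Fin.Subset using (Subset; _∈_; _∉_; ∁; _∩_; _─_; ⁅_⁆; ∣_∣; ⊥)
open import Data.Fin.Subset.Properties
  using (_∈?_; x∈⁅x⁆; x∈⁅y⁆⇒x≡y; x∉p⇒x∈∁p; x∈p∧x∉q⇒x∈p─q; p─q⊆p)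
open import Data.Product using (∃; _×_; _,_; proj₁; proj₂)
open import Data.Sum using (inj₁; inj₂)
open import Data.Empty using (⊥-elim)
open import Relation.Nullary using (yes; no; ¬_)
open import Relation.Binary.PropositionalEquality

∣p∣≡∣p∩q∣+∣p─q∣ : ∀ {n} (p q : Subset n) → ∣ p ∣ ≡ ∣ p ∩ q ∣ + ∣ p ─ q ∣
∣p∣≡∣p∩q∣+∣p─q∣ []          []          = refl
∣p∣≡∣p∩q∣+∣p─q∣ (true ∷ p)  (true ∷ q)  = cong suc (∣p∣≡∣p∩q∣+∣p─q∣ p q)
∣p∣≡∣p∩q∣+∣p─q∣ (true ∷ p)  (false ∷ q) =
  trans (cong suc (∣p∣≡∣p∩q∣+∣p─q∣ p q)) (sym (+-suc ∣ p ∩ q ∣ ∣ p ─ q ∣))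
∣p∣≡∣p∩q∣+∣p─q∣ (false ∷ p) (true ∷ q)  = ∣p∣≡∣p∩q∣+∣p─q∣ p q
∣p∣≡∣p∩q∣+∣p─q∣ (false ∷ p) (false ∷ q) = ∣p∣≡∣p∩q∣+∣p─q∣ p q

∣p─q∣≡1 : ∀ {ℓ n} (p q : Subset n) → ∣ p ∣ ≡ suc ℓ → ∣ p ∩ q ∣ ≡ ℓ → ∣ p ─ q ∣ ≡ 1
∣p─q∣≡1 {ℓ} p q ∣p∣≡1+ℓ ∣p∩q∣≡ℓ = +-cancelˡ-≡ ℓ ∣ p ─ q ∣ 1 (begin
  ℓ + ∣ p ─ q ∣         ≡⟨ cong (_+ ∣ p ─ q ∣) ∣p∩q∣≡ℓ ⟨
  ∣ p ∩ q ∣ + ∣ p ─ q ∣ ≡⟨ ∣p∣≡∣p∩q∣+∣p─q∣ p q ⟨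
  ∣ p ∣                 ≡⟨ ∣p∣≡1+ℓ ⟩
  suc ℓ                 ≡⟨ +-comm 1 ℓ ⟩
  ℓ + 1                 ∎)
  where open ≡-Reasoning

∣p∣≡0⇒p≡⊥ : ∀ {n} (p : Subset n) → ∣ p ∣ ≡ 0 → p ≡ ⊥
∣p∣≡0⇒p≡⊥ []          _  = refl
∣p∣≡0⇒p≡⊥ (false ∷ p) ∣p∣≡0 = cong (false ∷_) (∣p∣≡0⇒p≡⊥ p ∣p∣≡0)

∣p∣≡1⇒singleton : ∀ {n} (p : Subset n) → ∣ p ∣ ≡ 1 → ∃ λ y → p ≡ ⁅ y ⁆
∣p∣≡1⇒singleton (true ∷ p)  ∣p∣≡1 =
  fzero , cong (true ∷_) (∣p∣≡0⇒p≡⊥ p (cong pred ∣p∣≡1))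
∣p∣≡1⇒singleton (false ∷ p) ∣p∣≡1 with ∣p∣≡1⇒singleton p ∣p∣≡1
... | y , p≡⁅y⁆ = fsuc y , cong (false ∷_) p≡⁅y⁆

∣p∣≡1∧x∈p⇒p≡⁅x⁆ : ∀ {n} {x : Fin n} (p : Subset n) → ∣ p ∣ ≡ 1 → x ∈ p → p ≡ ⁅ x ⁆
∣p∣≡1∧x∈p⇒p≡⁅x⁆ {x = x} p ∣p∣≡1 x∈p with ∣p∣≡1⇒singleton p ∣p∣≡1
... | y , p≡⁅y⁆ = trans p≡⁅y⁆ (cong ⁅_⁆ (sym (x∈⁅y⁆⇒x≡y y (subst (x ∈_) p≡⁅y⁆ x∈p))))

x∈p─q⇒x∉q : ∀ {n} {x : Fin n} (p q : Subset n) → x ∈ p ─ q → x ∉ q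
x∈p─q⇒x∉q (_ ∷ p) (true ∷ q)  (there x∈p─q) (there x∈q) = x∈p─q⇒x∉q p q x∈p─q x∈q
x∈p─q⇒x∉q (_ ∷ p) (false ∷ q) (there x∈p─q) (there x∈q) = x∈p─q⇒x∉q p q x∈p─q x∈q

iter-suc : ∀ {A : Set} (f : A → A) k x → iter f (suc k) x ≡ iter f k (f x)
iter-suc f zero    x = refl
iter-suc f (suc k) x = cong f (iter-suc f k x)

iter-fixed : ∀ {A : Set} (f : A → A) x → f x ≡ x → ∀ k → iter f k x ≡ x
iter-fixed f x fx≡x zero    = refl
iter-fixed f x fx≡x (suc k) = trans (cong f (iter-fixed f x fx≡x k)) fx≡x

module _ {m : ℕ} (T : RootedTree m) where

  root-descendant : ∀ {v} → InSubtree T v (root T) → v ≡ root T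
  root-descendant (k , e) = trans (sym e) (iter-fixed (par T) (root T) (par-root T) k)

  descendant-not-root : ∀ {v w} → v ≢ root T → InSubtree T v w → w ≢ root T
  descendant-not-root v≢r (k , e) refl = v≢r (root-descendant (k , e))

  child-descendant : ∀ {v w} k → iter (par T) (suc k) w ≡ v → InSubtree T v (par T w)
  child-descendant {w = w} k e = k , trans (sym (iter-suc (par T) k w)) e

  walk-head : ∀ {S a b} → WalkIn T S a b → S a
  walk-head (here s)     = s
  walk-head (step s _ _) = s

  -- A walk starting in T_w and ending outside T_w passes through par w:
  -- a step upward from w itself lands on par w, every other step (upward
  -- from a proper descendant of w, or downward) stays inside T_w.
  walk-exits-through-parent : ∀ {S a b} w → WalkIn T S a b →
    InSubtree T w a → ¬ InSubtree T w b → S (par T w)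
  walk-exits-through-parent w (here s) a∈Tw b∉Tw = ⊥-elim (b∉Tw a∈Tw)
  walk-exits-through-parent {S} w (step _ (inj₁ (_ , par-a≡b)) walk) (zero , refl) _ =
    subst S (sym par-a≡b) (walk-head walk)
  walk-exits-through-parent w (step _ (inj₁ (_ , refl)) walk) (suc k , e) b∉Tw =
    walk-exits-through-parent w walk (child-descendant k e) b∉Tw
  walk-exits-through-parent w (step {b = b} _ (inj₂ (_ , refl)) walk) (k , e) c∉Tw =
    walk-exits-through-parent w walk (suc k , trans (iter-suc (par T) k b) e) c∉Tw

  subtree-induction : (P : Fin m → Set) {v : Fin m} → v ≢ root T → P v →
    (∀ w → w ≢ root T → P (par T w) → P w) →
    ∀ w → InSubtree T v w → P w
  subtree-induction P {v} v≢r Pv inherit w (k , e) = down k w e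
    where
    down : ∀ k w → iter (par T) k w ≡ v → P w
    down zero    w refl = Pv
    down (suc k) w e    = inherit w (descendant-not-root v≢r (suc k , e))
                            (down k (par T w) (proj₂ (child-descendant k e)))

module _ {n m : ℕ} {G : Graph n} (D : TreeDecomposition G m) where

  private
    r : Fin m
    r = root (T D)

    p[_] : Fin m → Fin m
    p[ w ] = par (T D) w

  entering-not-in-root : ∀ {w y} → w ≢ r → y ∈ B D w → y ∉ B D p[ w ] → y ∉ B D r
  entering-not-in-root {w} {y} w≢r y∈Bw y∉Bp y∈Br = y∉Bp
    (walk-exits-through-parent (T D) w (walk w r y∈Bw y∈Br) (zero , refl)
      (λ r∈Tw → w≢r (root-descendant (T D) r∈Tw)))
    where walk = proj₂ (vtxConn D y)

  module _ {ℓ : ℕ} (complete : Complete ℓ D) where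

    private
      bag-size : ∀ w → ∣ B D w ∣ ≡ suc ℓ
      bag-size = proj₁ complete

      edge-overlap : ∀ w w' → TEdge (T D) w w' → ∣ B D w ∩ B D w' ∣ ≡ ℓ
      edge-overlap = proj₂ complete

    entering-vertex : ∀ {w} → w ≢ r → ∃ λ y → B D w ─ B D p[ w ] ≡ ⁅ y ⁆
    entering-vertex {w} w≢r = ∣p∣≡1⇒singleton (B D w ─ B D p[ w ])
      (∣p─q∣≡1 (B D w) (B D p[ w ]) (bag-size w) (edge-overlap w p[ w ] (inj₁ (w≢r , refl))))

    leaving-vertex : ∀ {w z} → w ≢ r → z ∈ B D p[ w ] → z ∉ B D w →
      B D p[ w ] ─ B D w ≡ ⁅ z ⁆
    leaving-vertex {w} w≢r z∈Bp z∉Bw = ∣p∣≡1∧x∈p⇒p≡⁅x⁆ (B D p[ w ] ─ B D w)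
      (∣p─q∣≡1 (B D p[ w ]) (B D w) (bag-size p[ w ])
        (edge-overlap p[ w ] w (inj₂ (w≢r , refl))))
      (x∈p∧x∉q⇒x∈p─q z∈Bp z∉Bw)

    colour-descends : ∀ {C : Set} (α : Fin n → C) → Coherent D (∁ (B D r)) α →
      (a : C) → (∀ z → z ∈ B D r → α z ≢ a) →
      ∀ w → w ≢ r →
      (∃ λ z → z ∈ B D p[ w ] × α z ≡ a) → ∃ λ z → z ∈ B D w × α z ≡ a
    colour-descends α (parents-agree , _) a a∉root w w≢r (z , z∈Bp , αz≡a)
      with z ∈? B D w
    ... | yes z∈Bw = z , z∈Bw , αz≡a
    ... | no  z∉Bw = y , y∈Bw , trans (sym αz≡αy) αz≡a
      where
      entering = entering-vertex w≢r
      y : Fin n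
      y = proj₁ entering

      Bw─Bp≡⁅y⁆ : B D w ─ B D p[ w ] ≡ ⁅ y ⁆
      Bw─Bp≡⁅y⁆ = proj₂ entering

      y∈Bw─Bp : y ∈ B D w ─ B D p[ w ]
      y∈Bw─Bp = subst (y ∈_) (sym Bw─Bp≡⁅y⁆) (x∈⁅x⁆ y)

      y∈Bw : y ∈ B D w
      y∈Bw = p─q⊆p (B D w) (B D p[ w ]) y∈Bw─Bp

      z-y-parents : Parents D z y
      z-y-parents = p[ w ] , w , inj₂ (w≢r , refl) ,
                    leaving-vertex w≢r z∈Bp z∉Bw , Bw─Bp≡⁅y⁆

      αz≡αy : α z ≡ α y
      αz≡αy = parents-agree z y
        (x∉p⇒x∈∁p (λ z∈Br → a∉root z z∈Br αz≡a))
        (x∉p⇒x∈∁p (entering-not-in-root w≢r y∈Bw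
          (x∈p─q⇒x∉q (B D w) (B D p[ w ]) y∈Bw─Bp)))
        z-y-parents

lemma5 : {n m ℓ : ℕ} {G : Graph n} (D : TreeDecomposition G m) →
    Complete ℓ D → {C : Set} (α : Fin n → C) → ProperColoring G α →
    Coherent D (∁ (B D (root (T D)))) α →
    (a : C) → (∀ z → z ∈ B D (root (T D)) → α z ≢ a) →
    (v : Fin m) → v ≢ root (T D) →
    (∃ λ z → z ∈ B D v × α z ≡ a) →
    ∀ w → InSubtree (T D) v w → ∃ λ z → z ∈ B D w × α z ≡ a
lemma5 D complete α _ coherent a a∉root v v≢r a∈Bv =
  subtree-induction (T D) (λ w → ∃ λ z → z ∈ B D w × α z ≡ a) v≢r a∈Bv
    (colour-descends D complete α coherent a a∉root)
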